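{- Let $\mathbf{R}^{\mathrm{o}}=\{r_1,\dots,r_n\}$ be a finite set of obligations, $\mathbf{R}=(\emptyset,\mathbf{R}^{\mathrm{o}})$, and $a,x$ Boolean formulas. If $x\in\bigcap\mathit{outf}(\mathbf{R}^{\mathrm{o}}_{\triangleright},a,\{a\})$, with $out_4^{+}$ as the underlying I/O operation, then $(\{\Diamond a\},\mathbf{R})\mid\sim\bigcirc(x/a)$.
   Context: Obligations are $\bigcirc(x/a)$ with $a,x$ Boolean (body $b=a$, head $h=x$); $\Diamond a:=\neg\Box\neg a$. Override: relative to a fixed set $\Gamma$ of alethic formulas ($\Box$ over Boolean formulas), $r_j\triangleright r_i$ iff (i) $\{h(r_i),h(r_j)\}\cup\Gamma\models_{\mathrm{S5}}\bot$, (ii) $b(r_j)\models_{\mathrm{PL}}b(r_i)$ and $b(r_i)\not\models_{\mathrm{PL}}b(r_j)$, (iii) $h(r_i)\wedge b(r_j)\not\models_{\mathrm{PL}}\bot$. $V(w)=\{r_i\in\mathbf{R}^{\mathrm{o}}: w\models b(r_i)\wedge\neg h(r_i)$ and $w\not\models b(r_j)$ for all $r_j\triangleright r_i\}$. An $\mathbf{R}$-ordered model is $(W,\succeq_N,\succeq_I,v)$ with $W$ nonempty, valuation $v$, $\succeq_N=W\times W$, and $w_1\succeq_I w_2$ iff $V(w_1)\subseteq V(w_2)$; it is replete if every PL-consistent Boolean formula is true at some world. Standing assumption for this result: all models considered are replete. $\max_{\succeq}(X)=\{w\in X:\forall u\in X(u\succeq w\Rightarrow w\succeq u)\}$; $\Vert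 a\Vert$ the truth set. Truth: $M,w\models\Box A$ iff $\Vert A\Vert=W$; $M,w\models\bigcirc(B/A)$ iff $\max_{\succeq_N}(\Vert A\wedge\neg B\Vert)\not\succeq_I^{s}\max_{\succeq_N}(\Vert A\wedge B\Vert)$, where $U\succeq_I^{s}U'$ iff every $u'\in U'$ has some $u\in U$ with $u\succeq_I u'$. Entailment: $(\Gamma,\mathbf{R})\mid\sim A$ iff for every (replete) $\mathbf{R}$-ordered model $M$ and world $w$ at which all of $\Gamma$ holds, $M,w\models A$. Translation: for $r_i=\bigcirc(x/a)$, $D(r_i)=\{r_j: r_j\triangleright r_i\}$; $r_i^{\triangleright}=(a\wedge\bigwedge_{r_j\in D(r_i)}\neg b(r_j),\,x)$ if $D(r_i)\neq\emptyset$, else $(a,x)$; $\mathbf{R}^{\mathrm{o}}_{\triangleright}=\{r_1^{\triangleright},\dots,r_n^{\triangleright}\}$. I/O logic: for a set $N$ of pairs $(c,y)$ of Boolean formulas, $\mathrm{m}(N)=\{c\rightarrow y:(c,y)\in N\}$, $out_4^{+}(N,a)=\{y:\{a\}\cup\mathrm{m}(N)\models_{\mathrm{PL}}y\}$; $\mathit{maxf}(N,a,C)$ is the set of $\subseteq$-maximal $H\subseteq N$ with $out_4^{+}(H,a)\cup C$ PL-consistent; $\mathit{outf}(N,a,C)=\{out_4^{+}(H,a): H\in\mathit{maxf}(N,a,C)\}$. -}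

module Defs where

open import Data.Nat using (ℕ)
open import Level using (Level)
open import Data.Bool using (Bool; true; false; T; not; _∧_; _∨_)
open import Data.Fin using (Fin)
open import Data.Fin.Subset using (Subset; _∈_; _⊆_)
open import Data.List using (List; []; _∷_; map)
open import Data.List.Relation.Unary.All using (All)
open import Data.List.Membership.Propositional using () renaming (_∈_ to _∈ˡ_)
open import Data.Product using (Σ; ∃; _×_; _,_; proj₁; proj₂)
open import Data.Unit using (⊤)
open import Data.Empty using (⊥)
open import Data.Sum using (_⊎_)
open import Relation.Nullary using (¬_)
open import Relation.Binary.PropositionalEquality using (_≡_)
open import Function.Bundles using (_⇔_)

data Form : Set where
  fvar   : ℕ → Form
  ftrue  : Form
  ffalse : Form
  fnot   : Form → Form
  fand   : Form → Form → Form
  for    : Form → Form → Form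
  fimp   : Form → Form → Form

Val : Set
Val = ℕ → Bool

eval : Val → Form → Bool
eval v (fvar p)   = v p
eval v ftrue      = true
eval v ffalse     = false
eval v (fnot φ)   = not (eval v φ)
eval v (fand φ ψ) = eval v φ ∧ eval v ψ
eval v (for φ ψ)  = eval v φ ∨ eval v ψ
eval v (fimp φ ψ) = not (eval v φ) ∨ eval v ψ

_⊨_ : Val → Form → Set
v ⊨ φ = T (eval v φ)

_⊨PL_ : Form → Form → Set
φ ⊨PL ψ = ∀ (v : Val) → v ⊨ φ → v ⊨ ψ

PLConsistent : Form → Set
PLConsistent φ = ∃ λ (v : Val) → v ⊨ φ

PLConsistentSet : (Form → Set) → Set
PLConsistentSet S = ∃ λ (v : Val) → ∀ (y : Form) → S y → v ⊨ y

data AForm : Set where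
  atom : Form → AForm
  box  : Form → AForm
  anot : AForm → AForm
  aand : AForm → AForm → AForm

dia : Form → AForm
dia a = anot (box (fnot a))

asat : (W : Set) → (W → Val) → W → AForm → Set
asat W val w (atom φ)   = val w ⊨ φ
asat W val w (box φ)    = ∀ (u : W) → val u ⊨ φ
asat W val w (anot A)   = ¬ asat W val w A
asat W val w (aand A B) = asat W val w A × asat W val w B

-- S5 unsatisfiability of a finite set Δ of alethic formulas: Δ ⊨S5 ⊥
-- (S5 models: nonempty set of worlds, universal accessibility)
S5Unsat : List AForm → Set₁
S5Unsat Δ = ∀ (W : Set) (val : W → Val) (w : W) → All (asat W val w) Δ → ⊥

record Obligation : Set where
  constructor ○⟨_∣_⟩
  field
    head : Form
    body : Form
open Obligation public

Override : ∀ {n} → List AForm → (Fin n → Obligation) → Fin n → Fin n → Set₁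
Override Γ R j i =
  S5Unsat (atom (head (R i)) ∷ atom (head (R j)) ∷ Γ)
  × ((body (R j) ⊨PL body (R i)) × ¬ (body (R i) ⊨PL body (R j)))
  × ¬ (fand (head (R i)) (body (R j)) ⊨PL ffalse)

record RModel : Set₁ where
  field
    W   : Set
    w₀  : W            -- W nonempty
    val : W → Val
open RModel public

truthSet : (M : RModel) → Form → W M → Set
truthSet M φ u = val M u ⊨ φ

Viol : ∀ {n} → List AForm → (Fin n → Obligation) → (M : RModel) → W M → Fin n → Set₁
Viol Γ R M w i =
  (val M w ⊨ fand (body (R i)) (fnot (head (R i))))
  × (∀ j → Override Γ R j i → ¬ (val M w ⊨ body (R j)))

≽N : (M : RModel) → W M → W M → Set
≽N M _ _ = ⊤

≽I : ∀ {n} → List AForm → (Fin n → Obligation) → (M : RModel) → W M → W M → Set₁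
≽I Γ R M w₁ w₂ = ∀ i → Viol Γ R M w₁ i → Viol Γ R M w₂ i

maxBy : ∀ {ℓ} {A : Set} → (A → A → Set ℓ) → (A → Set) → A → Set ℓ
maxBy _≽_ X w = X w × (∀ u → X u → u ≽ w → w ≽ u)

≽s : ∀ {ℓ} {A : Set} → (A → A → Set ℓ) → (A → Set) → (A → Set) → Set ℓ
≽s _≽_ U U' = ∀ u' → U' u' → Σ _ λ u → U u × (u ≽ u')

HoldsOb : ∀ {n} → List AForm → (Fin n → Obligation) → (M : RModel) → W M → Obligation → Set₁
HoldsOb Γ R M w o =
  ¬ ≽s (≽I Γ R M)
       (maxBy (≽N M) (truthSet M (fand (body o) (fnot (head o)))))
       (maxBy (≽N M) (truthSet M (fand (body o) (head o))))

Replete : RModel → Set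
Replete M = ∀ (φ : Form) → PLConsistent φ → ∃ λ (w : W M) → val M w ⊨ φ

-- (Γ, R) |~ ○(x/a), with R = (∅, R^o); over replete R-ordered models
Entails : ∀ {n} → List AForm → (Fin n → Obligation) → Obligation → Set₁
Entails Γ R o =
  ∀ (M : RModel) → Replete M → ∀ (w : W M) →
    All (asat (W M) (val M) w) Γ → HoldsOb Γ R M w o

bigAnd : Form → List Form → Form
bigAnd c []       = c
bigAnd c (d ∷ ds) = fand c (bigAnd d ds)

transBody : ∀ {n} → (Fin n → Obligation) → Form → List (Fin n) → Form
transBody R a []       = a
transBody R a (j ∷ js) = fand a (bigAnd (fnot (body (R j))) (map (λ k → fnot (body (R k))) js))

-- N i = r_i^▷ where the list L_i enumerates exactly D(r_i) = {j | r_j ▷ r_i}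
IsTranslation : ∀ {n} → List AForm → (Fin n → Obligation) → (Fin n → Form × Form) → Set₁
IsTranslation Γ R N =
  ∀ i → Σ (List _) λ L →
      (∀ j → (j ∈ˡ L → Override Γ R j i) × (Override Γ R j i → j ∈ˡ L))
    × (N i ≡ (transBody R (body (R i)) L , head (R i)))

-- y ∈ out₄⁺(H, a), H ⊆ N given as a subset of indices
out4+ : ∀ {n} → (Fin n → Form × Form) → Subset n → Form → Form → Set
out4+ N H a y =
  ∀ (v : Val) → v ⊨ a → (∀ i → i ∈ H → v ⊨ fimp (proj₁ (N i)) (proj₂ (N i))) → v ⊨ y

OutCons : ∀ {n} → (Fin n → Form × Form) → Form → (Form → Set) → Subset n → Set
OutCons N a C H = PLConsistentSet (λ y → out4+ N H a y ⊎ C y)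

InMaxf : ∀ {n} → (Fin n → Form × Form) → Form → (Form → Set) → Subset n → Set
InMaxf N a C H = OutCons N a C H × (∀ H' → H ⊆ H' → OutCons N a C H' → H' ⊆ H)

InBigCapOutf : ∀ {n} → (Fin n → Form × Form) → Form → (Form → Set) → Form → Set₁
InBigCapOutf N a C x = ∀ S → (∃ λ H → InMaxf N a C H × (S ≡ out4+ N H a)) → S x

{-# OPTIONS --safe #-}
-- Suppose every a ∧ x world were ⪰_I-dominated by an a ∧ ¬x world. Since ◇a
-- makes {a} consistent, maxf(R^o_▷, a, {a}) has a member H, and x ∈ out₄⁺(H, a).
-- By repleteness some world u' satisfies a and the materialisations of H,
-- hence x; so some a ∧ ¬x world u has V(u) ⊆ V(u'). The translation is built
-- so that V(w) is exactly the set of translated rules whose materialisation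
-- fails at w; hence u satisfies the materialisations of H as well, and thus x,
-- a contradiction. The goal being a negation, the two classical steps (a
-- maximal H, a valuation satisfying a) are taken in the double-negation monad.
module Submission where

open import Defs
open import Data.Nat using (ℕ)
open import Data.Fin using (Fin)
open import Data.List using (List; []; _∷_)
open import Data.Product using (_×_)
open import Relation.Binary.PropositionalEquality using (_≡_)

open import Data.Bool using (true; false)
open import Data.Bool.Properties using (T-∧)
open import Data.Empty using (⊥-elim)
open import Data.Fin using (zero; suc)
open import Data.Nat using (zero; suc)
open import Data.Fin.Subset using (Subset; inside; outside; _∈_; _⊆_) renaming (⊥ to ∅)
open import Data.Fin.Subset.Properties using (∉⊥; ⊥⊆; s⊆s; in⊆in; drop-∷-⊆)
open import Data.List using (map)
open import Data.List.Relation.Unary.All as All using (All; []; _∷_)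
open import Data.List.Relation.Unary.All.Properties using (map⁺; map⁻)
open import Data.Product using (∃; _,_; proj₁; proj₂)
open import Data.Sum as Sum using (inj₁)
open import Data.Unit using (tt)
open import Data.Vec using ([]; _∷_; here; there)
open import Function using (_∘_; id; case_of_)
open import Function.Bundles using (_⇔_; mk⇔; Equivalence)
open import Relation.Binary.PropositionalEquality using (refl)
open import Relation.Nullary using (¬_; yes; no)
open import Relation.Nullary.Decidable using (¬¬-excluded-middle)

open Equivalence using (to; from)

⊨-fand : ∀ {v} φ ψ → v ⊨ fand φ ψ ⇔ (v ⊨ φ × v ⊨ ψ)
⊨-fand {v} φ ψ = T-∧ {eval v φ} {eval v ψ}

⊨-fnot : ∀ {v} φ → v ⊨ fnot φ ⇔ (¬ v ⊨ φ)
⊨-fnot {v} φ with eval v φ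
... | true  = mk⇔ (λ ()) (λ ¬t → ¬t tt)
... | false = mk⇔ (λ _ ()) _

materialisation : Form × Form → Form
materialisation r = fimp (proj₁ r) (proj₂ r)

Violates : Val → Form × Form → Set
Violates v r = v ⊨ proj₁ r × ¬ v ⊨ proj₂ r

⊨-materialisation : ∀ {v} r → v ⊨ materialisation r ⇔ (¬ Violates v r)
⊨-materialisation {v} (c , y) with eval v c | eval v y
... | false | _     = mk⇔ (λ _ → proj₁) _
... | true  | true  = mk⇔ (λ _ (_ , ¬t) → ¬t tt) _
... | true  | false = mk⇔ (λ ()) (λ ¬viol → ¬viol (tt , id))

⊨-bigAnd : ∀ {v} φ φs → v ⊨ bigAnd φ φs ⇔ All (v ⊨_) (φ ∷ φs)
⊨-bigAnd φ []       = mk⇔ (_∷ []) All.head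
⊨-bigAnd φ (ψ ∷ ψs) = mk⇔
  (λ t → let p , q = to (⊨-fand φ (bigAnd ψ ψs)) t in p ∷ to (⊨-bigAnd ψ ψs) q)
  (λ { (p ∷ ps) → from (⊨-fand φ (bigAnd ψ ψs)) (p , from (⊨-bigAnd ψ ψs) ps) })

⊨-transBody : ∀ {n} (R : Fin n → Obligation) {v} a L →
              v ⊨ transBody R a L ⇔ (v ⊨ a × All (λ j → ¬ v ⊨ body (R j)) L)
⊨-transBody R a []       = mk⇔ (_, []) proj₁
⊨-transBody R {v} a (j ∷ js) = mk⇔
  (λ t → let p , q = to (⊨-fand a ⋀¬bodies) t in
         p , All.map (λ {k} → to (⊨-fnot (body (R k)))) (map⁻ (to ⊨-⋀¬bodies q)))
  (λ (p , qs) → from (⊨-fand a ⋀¬bodies)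
         (p , from ⊨-⋀¬bodies (map⁺ (All.map (λ {k} → from (⊨-fnot (body (R k)))) qs))))
  where
  ¬body : Fin _ → Form
  ¬body k = fnot (body (R k))
  ⋀¬bodies : Form
  ⋀¬bodies = bigAnd (¬body j) (map ¬body js)
  ⊨-⋀¬bodies : v ⊨ ⋀¬bodies ⇔ All (v ⊨_) (map ¬body (j ∷ js))
  ⊨-⋀¬bodies = ⊨-bigAnd (¬body j) (map ¬body js)

⋀ : ∀ {n} → Subset n → (Fin n → Form) → Form
⋀ []            f = ftrue
⋀ (inside ∷ H)  f = fand (f zero) (⋀ H (f ∘ suc))
⋀ (outside ∷ H) f = ⋀ H (f ∘ suc)

⊨-⋀ : ∀ {n v} (H : Subset n) f → v ⊨ ⋀ H f ⇔ (∀ i → i ∈ H → v ⊨ f i)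
⊨-⋀ []            f = mk⇔ (λ _ _ ()) _
⊨-⋀ (inside ∷ H)  f = mk⇔
  (λ t → let p , q = to (⊨-fand (f zero) (⋀ H (f ∘ suc))) t in
         λ { zero here → p ; (suc i) (there i∈H) → to (⊨-⋀ H (f ∘ suc)) q i i∈H })
  (λ h → from (⊨-fand (f zero) (⋀ H (f ∘ suc)))
         (h zero here , from (⊨-⋀ H (f ∘ suc)) (λ i → h (suc i) ∘ there)))
⊨-⋀ (outside ∷ H) f = mk⇔
  (λ t → λ { (suc i) (there i∈H) → to (⊨-⋀ H (f ∘ suc)) t i i∈H })
  (λ h → from (⊨-⋀ H (f ∘ suc)) (λ i → h (suc i) ∘ there))

DownwardClosed : ∀ {n} → (Subset n → Set) → Set
DownwardClosed P = ∀ {H H'} → H ⊆ H' → P H' → P H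

Maximal : ∀ {n} → (Subset n → Set) → Subset n → Set
Maximal P H = P H × (∀ H' → H ⊆ H' → P H' → H' ⊆ H)

maximal-exists : ∀ {n} {P : Subset n → Set} → DownwardClosed P → P ∅ →
                 ¬ ¬ ∃ (Maximal P)
maximal-exists {zero}  _    p∅ k = k ([] , p∅ , λ { [] _ _ → id })
maximal-exists {suc n} {P} down p∅ k = ¬¬-excluded-middle λ where
    (yes p₀) → maximal-exists (down ∘ s⊆s) p₀ (k ∘ with-inside)
    (no ¬p₀) → maximal-exists (down ∘ s⊆s) p∅ (k ∘ with-outside ¬p₀)
  where
  with-inside : ∃ (Maximal (P ∘ (inside ∷_))) → ∃ (Maximal P)
  with-inside (H , pH , max) = inside ∷ H , pH , λ where
    (outside ∷ H') H⊆H' _  → case H⊆H' here of λ ()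
    (inside ∷ H')  H⊆H' pH' → in⊆in (max H' (drop-∷-⊆ H⊆H') pH')
  with-outside : ¬ P (inside ∷ ∅) → ∃ (Maximal (P ∘ (outside ∷_))) → ∃ (Maximal P)
  with-outside ¬p₀ (H , pH , max) = outside ∷ H , pH , λ where
    (outside ∷ H') H⊆H' pH' → s⊆s (max H' (drop-∷-⊆ H⊆H') pH')
    (inside ∷ H')  _    pH' → ⊥-elim (¬p₀ (down (in⊆in ⊥⊆) pH'))

module _ {n} (N : Fin n → Form × Form) (a : Form) where

  out4+-mono : ∀ {H H' y} → H ⊆ H' → out4+ N H a y → out4+ N H' a y
  out4+-mono H⊆H' y∈out v v⊨a v⊨H' = y∈out v v⊨a (λ i → v⊨H' i ∘ H⊆H')

  OutCons-antitone : (C : Form → Set) → DownwardClosed (OutCons N a C)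
  OutCons-antitone C H⊆H' (v , v⊨out∪C) =
    v , λ y → v⊨out∪C y ∘ Sum.map₁ (out4+-mono {y = y} H⊆H')

  OutCons-∅ : ∀ {C v} → v ⊨ a → (∀ y → C y → v ⊨ y) → OutCons N a C ∅
  OutCons-∅ {v = v} v⊨a v⊨C =
    v , λ y → Sum.[ (λ y∈out → y∈out v v⊨a (λ _ → ⊥-elim ∘ ∉⊥)) , v⊨C y ]

  OutCons⇒consistent : ∀ {C H} → OutCons N a C H →
                       PLConsistent (fand a (⋀ H (materialisation ∘ N)))
  OutCons⇒consistent {H = H} (v , v⊨out∪C) = v , from (⊨-fand a (⋀ H m))
    (v⊨out∪C a (inj₁ λ _ v⊨a _ → v⊨a) ,
     from (⊨-⋀ H m) λ i i∈H → v⊨out∪C (m i) (inj₁ λ _ _ v⊨H → v⊨H i i∈H))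
    where
    m : Fin n → Form
    m = materialisation ∘ N

◇-consistent : ∀ {W} (val : W → Val) w a → asat W val w (dia a) → ¬ ¬ PLConsistent a
◇-consistent val w a ◇a ¬consistent =
  ◇a λ u → from (⊨-fnot a) λ u⊨a → ¬consistent (val u , u⊨a)

maxBy-≽N : ∀ (M : RModel) {X u} → X u → maxBy (≽N M) X u
maxBy-≽N M u∈X = u∈X , λ _ _ _ → tt

module _ {n} {Γ : List AForm} {R : Fin n → Obligation} {N : Fin n → Form × Form}
         (translation : IsTranslation Γ R N) (M : RModel) where

  Viol⇔Violates : ∀ w i → Viol Γ R M w i ⇔ Violates (val M w) (N i)
  Viol⇔Violates w i with translation i
  ... | L , ▷i⇔∈L , N≡ rewrite N≡ = mk⇔
    (λ (w⊨b∧¬h , unoverridden) →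
      let w⊨b , w⊨¬h = to (⊨-fand b (fnot h)) w⊨b∧¬h in
      from (⊨-transBody R b L)
        (w⊨b , All.tabulate λ {j} j∈L → unoverridden j (proj₁ (▷i⇔∈L j) j∈L)) ,
      to (⊨-fnot h) w⊨¬h)
    (λ (w⊨b▷ , w⊭h) →
      let w⊨b , w⊭bodies = to (⊨-transBody R b L) w⊨b▷ in
      from (⊨-fand b (fnot h)) (w⊨b , from (⊨-fnot h) w⊭h) ,
      λ j j▷i → All.lookup w⊭bodies (proj₂ (▷i⇔∈L j) j▷i))
    where
    b h : Form
    b = body (R i)
    h = head (R i)

  ≽I-preserves-materialisation : ∀ {u u'} → ≽I Γ R M u u' → ∀ i →
    val M u' ⊨ materialisation (N i) → val M u ⊨ materialisation (N i)
  ≽I-preserves-materialisation u≽u' i u'⊨m =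
    from (⊨-materialisation (N i)) λ u-violates →
      to (⊨-materialisation (N i)) u'⊨m
        (to (Viol⇔Violates _ i) (u≽u' i (from (Viol⇔Violates _ i) u-violates)))

  out4+⇒HoldsOb : Replete M → ∀ {H a x} w →
                  PLConsistent (fand a (⋀ H (materialisation ∘ N))) →
                  out4+ N H a x → HoldsOb Γ R M w ○⟨ x ∣ a ⟩
  out4+⇒HoldsOb replete {H} {a} {x} w consistent x∈out a∧¬x≽a∧x =
    let u' , u'⊨a∧H = replete (fand a (⋀ H m)) consistent
        u'⊨a , u'⊨H = to (⊨-fand a (⋀ H m)) u'⊨a∧H
        u'⊨x        = x∈out (val M u') u'⊨a (to (⊨-⋀ H m) u'⊨H)
        u'⊨a∧x      = from (⊨-fand a x) (u'⊨a , u'⊨x)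
        u , (u⊨a∧¬x , _) , u≽u' = a∧¬x≽a∧x u' (maxBy-≽N M u'⊨a∧x)
        u⊨a , u⊨¬x  = to (⊨-fand a (fnot x)) u⊨a∧¬x
    in to (⊨-fnot x) u⊨¬x (x∈out (val M u) u⊨a λ i i∈H →
         ≽I-preserves-materialisation u≽u' i (to (⊨-⋀ H m) u'⊨H i i∈H))
    where
    m : Fin n → Form
    m = materialisation ∘ N

theorem4 : ∀ {n : ℕ} (R : Fin n → Obligation) (a x : Form)
             (N : Fin n → Form × Form) →
             IsTranslation (dia a ∷ []) R N →
             InBigCapOutf N a (λ y → y ≡ a) x →
             Entails (dia a ∷ []) R ○⟨ x ∣ a ⟩
theorem4 R a x N translation x∈⋂outf M replete w (◇a ∷ []) a∧¬x≽a∧x =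
  ◇-consistent (val M) w a ◇a λ (v , v⊨a) →
  maximal-exists (OutCons-antitone N a _) (OutCons-∅ N a v⊨a λ { _ refl → v⊨a })
    λ (H , H-maximal) →
  out4+⇒HoldsOb translation M replete {H} {a} {x} w
    (OutCons⇒consistent N a (proj₁ H-maximal))
    (x∈⋂outf _ (H , H-maximal , refl))
    a∧¬x≽a∧x
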